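{- Every deduction in $\mathbf{I}$ in normal form has the subformula property: every formula occurring in it is a subformula either of its conclusion or of one of its undischarged assumptions.
   Context: Formulas of intuitionistic propositional logic are built from atomic formulas using the connectives $\bot$ (0-ary), $\land$, $\lor$, $\supset$; $\bot$ is not atomic. Subformulas are defined as usual (each formula is a subformula of itself). The natural deduction system $\mathbf{I}$ has tree-shaped deductions with assumptions at the leaves, grouped into assumption classes (occurrences of the same formula; a rule discharging a class discharges all its members). Rules: - $\land I$: from deductions of $A$, of $B$, and of $C$ from $[A\land B]$, conclude $C$. - $\supset I$: from a deduction of $B$ from $[A]$ and a deduction of $C$ from $[A\supset B]$, conclude $C$. - $\lor I$: from a deduction of $A$ (or of $B$) and a deduction of $C$ from $[A\lor B]$, conclude $C$. - $\land E$: from $A\land B$ and a deduction of $C$ from $[A],[B]$, conclude $C$. - $\supset E$: from $A\supset B$, $A$, and a deduction of $C$ from $[B]$, conclude $C$. - $\lor E$: from $A\lor B$, a deduction of $C$ from $[A]$ and one of $C$ from $[B]$, conclude $C$. - $\bot E$: from $\bot$ conclude $C$. A single assumption occurrence is a deduction. Standing conventions: no vacuous discharge above arbitrary premises; $\bot E$ has atomic conclusions. In elimination rules, $A\land B,A\supset B,A\lor B,\bot$ are major premises and the $C$'s are arbitrary premises; in introduction rules the $C$ is the arbitrary premise and the discharged $A\land B, A\supset B, A\lor B$ are major assumptions discharged. A maximal formula with main operator $\ast$ is an occurrence of $A\ast B$ that is both the major premise of $\ast E$ and a major assumption discharged by $\ast I$. A segment is a sequence $C_1,\dots,C_n$ ($n>1$)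 of occurrences of the same formula, each $C_i$ ($i<n$) an arbitrary premise of a rule with conclusion $C_{i+1}$, and $C_n$ not an arbitrary premise. A maximal segment is a segment whose last formula is the major premise of an elimination rule. A deduction is in normal form if it contains no maximal formula and no maximal segment. -}

module Defs where

open import Data.Nat using (ℕ; zero; suc)
open import Data.Fin using (toℕ)
open import Data.List using (List; []; _∷_; _++_)
open import Data.List.Membership.Propositional using (_∈_)
open import Data.List.Relation.Unary.Any using (here; there; index)
open import Data.Product using (Σ; _×_)
open import Data.Sum using (_⊎_)
open import Data.Empty using (⊥)
open import Data.Unit using (⊤)
open import Relation.Binary.PropositionalEquality using (_≡_)

infixr 6 _∧_
infixr 5 _∨_
infixr 4 _⊃_

data Form : Set where
  atom : ℕ → Form
  ⊥'   : Form
  _∧_  : Form → Form → Form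
  _∨_  : Form → Form → Form
  _⊃_  : Form → Form → Form

data _⊑_ : Form → Form → Set where
  ⊑-refl : ∀ {A} → A ⊑ A
  ⊑-∧ˡ   : ∀ {F A B} → F ⊑ A → F ⊑ (A ∧ B)
  ⊑-∧ʳ   : ∀ {F A B} → F ⊑ B → F ⊑ (A ∧ B)
  ⊑-∨ˡ   : ∀ {F A B} → F ⊑ A → F ⊑ (A ∨ B)
  ⊑-∨ʳ   : ∀ {F A B} → F ⊑ B → F ⊑ (A ∨ B)
  ⊑-⊃ˡ   : ∀ {F A B} → F ⊑ A → F ⊑ (A ⊃ B)
  ⊑-⊃ʳ   : ∀ {F A B} → F ⊑ B → F ⊑ (A ⊃ B)

-- Deductions of the system I (general introduction and elimination rules).
-- `Ded Γ C` : deductions of conclusion C whose assumption classes that are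
-- not discharged inside the deduction are named by (de Bruijn) positions in Γ.
-- Each discharging rule pushes the discharged assumption class(es) onto the
-- context of the premise deduction(s) in which they are discharged.
-- An assumption class = all leaves `hyp x` referring to the same position.

data Ded (Γ : List Form) : Form → Set where
  hyp  : ∀ {A} → A ∈ Γ → Ded Γ A
  ∧I   : ∀ {A B C} → Ded Γ A → Ded Γ B → Ded ((A ∧ B) ∷ Γ) C → Ded Γ C
  ⊃I   : ∀ {A B C} → Ded (A ∷ Γ) B → Ded ((A ⊃ B) ∷ Γ) C → Ded Γ C
  ∨I₁  : ∀ {A B C} → Ded Γ A → Ded ((A ∨ B) ∷ Γ) C → Ded Γ C
  ∨I₂  : ∀ {A B C} → Ded Γ B → Ded ((A ∨ B) ∷ Γ) C → Ded Γ C
  -- ∧E : A ∧ B, and C from [A],[B]  ⟹  C   (B is position 0, A position 1)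
  ∧E   : ∀ {A B C} → Ded Γ (A ∧ B) → Ded (B ∷ A ∷ Γ) C → Ded Γ C
  ⊃E   : ∀ {A B C} → Ded Γ (A ⊃ B) → Ded Γ A → Ded (B ∷ Γ) C → Ded Γ C
  ∨E   : ∀ {A B C} → Ded Γ (A ∨ B) → Ded (A ∷ Γ) C → Ded (B ∷ Γ) C → Ded Γ C
  -- ⊥E : ⊥ ⟹ C, with C atomic (standing convention)
  ⊥E   : ∀ {n} → Ded Γ ⊥' → Ded Γ (atom n)

forms : ∀ {Γ C} → Ded Γ C → List Form
forms {C = C} (hyp x)        = C ∷ []
forms {C = C} (∧I d₁ d₂ d₃)  = C ∷ forms d₁ ++ forms d₂ ++ forms d₃
forms {C = C} (⊃I d₁ d₂)     = C ∷ forms d₁ ++ forms d₂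
forms {C = C} (∨I₁ d₁ d₂)    = C ∷ forms d₁ ++ forms d₂
forms {C = C} (∨I₂ d₁ d₂)    = C ∷ forms d₁ ++ forms d₂
forms {C = C} (∧E d₁ d₂)     = C ∷ forms d₁ ++ forms d₂
forms {C = C} (⊃E d₁ d₂ d₃)  = C ∷ forms d₁ ++ forms d₂ ++ forms d₃
forms {C = C} (∨E d₁ d₂ d₃)  = C ∷ forms d₁ ++ forms d₂ ++ forms d₃
forms {C = C} (⊥E d)         = C ∷ forms d

idx : ∀ {Γ : List Form} {A : Form} → A ∈ Γ → ℕ
idx x = toℕ (index x)

IsHyp : ∀ {Γ C} → ℕ → Ded Γ C → Set
IsHyp k (hyp x) = idx x ≡ k
IsHyp k _       = ⊥

Uses : ∀ {Γ C} → ℕ → Ded Γ C → Set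
Uses k (hyp x)        = idx x ≡ k
Uses k (∧I d₁ d₂ d₃)  = Uses k d₁ ⊎ Uses k d₂ ⊎ Uses (suc k) d₃
Uses k (⊃I d₁ d₂)     = Uses (suc k) d₁ ⊎ Uses (suc k) d₂
Uses k (∨I₁ d₁ d₂)    = Uses k d₁ ⊎ Uses (suc k) d₂
Uses k (∨I₂ d₁ d₂)    = Uses k d₁ ⊎ Uses (suc k) d₂
Uses k (∧E d₁ d₂)     = Uses k d₁ ⊎ Uses (suc (suc k)) d₂
Uses k (⊃E d₁ d₂ d₃)  = Uses k d₁ ⊎ Uses k d₂ ⊎ Uses (suc k) d₃
Uses k (∨E d₁ d₂ d₃)  = Uses k d₁ ⊎ Uses (suc k) d₂ ⊎ Uses (suc k) d₃
Uses k (⊥E d)         = Uses k d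

UndischargedAssumption : ∀ {Γ C} → Form → Ded Γ C → Set
UndischargedAssumption {Γ} A d = Σ (A ∈ Γ) λ x → Uses (idx x) d

-- Standing convention: no vacuous discharge above arbitrary premises, i.e.
-- every assumption class discharged in the deduction of an arbitrary
-- premise is non-empty. (The class [A] of ⊃I, discharged above the minor
-- premise B, may be vacuous.)
NoVacuous : ∀ {Γ C} → Ded Γ C → Set
NoVacuous (hyp x)       = ⊤
NoVacuous (∧I d₁ d₂ d₃) = Uses 0 d₃ × NoVacuous d₁ × NoVacuous d₂ × NoVacuous d₃
NoVacuous (⊃I d₁ d₂)    = Uses 0 d₂ × NoVacuous d₁ × NoVacuous d₂
NoVacuous (∨I₁ d₁ d₂)   = Uses 0 d₂ × NoVacuous d₁ × NoVacuous d₂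
NoVacuous (∨I₂ d₁ d₂)   = Uses 0 d₂ × NoVacuous d₁ × NoVacuous d₂
NoVacuous (∧E d₁ d₂)    = Uses 0 d₂ × Uses 1 d₂ × NoVacuous d₁ × NoVacuous d₂
NoVacuous (⊃E d₁ d₂ d₃) = Uses 0 d₃ × NoVacuous d₁ × NoVacuous d₂ × NoVacuous d₃
NoVacuous (∨E d₁ d₂ d₃) = Uses 0 d₂ × Uses 0 d₃ × NoVacuous d₁ × NoVacuous d₂ × NoVacuous d₃
NoVacuous (⊥E d)        = NoVacuous d

-- `MajorPremAt k d` : some occurrence of an assumption of class k in d is
-- the major premise of an elimination rule.  (The main operator of the
-- eliminated formula is the one of the class's formula, so an elimination
-- whose major premise belongs to a class discharged by ∗I is a ∗E.)
MajorPremAt : ∀ {Γ C} → ℕ → Ded Γ C → Set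
MajorPremAt k (hyp x)       = ⊥
MajorPremAt k (∧I d₁ d₂ d₃) = MajorPremAt k d₁ ⊎ MajorPremAt k d₂ ⊎ MajorPremAt (suc k) d₃
MajorPremAt k (⊃I d₁ d₂)    = MajorPremAt (suc k) d₁ ⊎ MajorPremAt (suc k) d₂
MajorPremAt k (∨I₁ d₁ d₂)   = MajorPremAt k d₁ ⊎ MajorPremAt (suc k) d₂
MajorPremAt k (∨I₂ d₁ d₂)   = MajorPremAt k d₁ ⊎ MajorPremAt (suc k) d₂
MajorPremAt k (∧E d₁ d₂)    = IsHyp k d₁ ⊎ MajorPremAt k d₁ ⊎ MajorPremAt (suc (suc k)) d₂
MajorPremAt k (⊃E d₁ d₂ d₃) = IsHyp k d₁ ⊎ MajorPremAt k d₁ ⊎ MajorPremAt k d₂ ⊎ MajorPremAt (suc k) d₃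
MajorPremAt k (∨E d₁ d₂ d₃) = IsHyp k d₁ ⊎ MajorPremAt k d₁ ⊎ MajorPremAt (suc k) d₂ ⊎ MajorPremAt (suc k) d₃
MajorPremAt k (⊥E d)        = IsHyp k d ⊎ MajorPremAt k d

-- `HasMaximalFormula d` : some major assumption discharged by an
-- introduction rule ∗I has an occurrence that is the major premise of ∗E.
HasMaximalFormula : ∀ {Γ C} → Ded Γ C → Set
HasMaximalFormula (hyp x)       = ⊥
HasMaximalFormula (∧I d₁ d₂ d₃) = MajorPremAt 0 d₃ ⊎ HasMaximalFormula d₁ ⊎ HasMaximalFormula d₂ ⊎ HasMaximalFormula d₃
HasMaximalFormula (⊃I d₁ d₂)    = MajorPremAt 0 d₂ ⊎ HasMaximalFormula d₁ ⊎ HasMaximalFormula d₂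
HasMaximalFormula (∨I₁ d₁ d₂)   = MajorPremAt 0 d₂ ⊎ HasMaximalFormula d₁ ⊎ HasMaximalFormula d₂
HasMaximalFormula (∨I₂ d₁ d₂)   = MajorPremAt 0 d₂ ⊎ HasMaximalFormula d₁ ⊎ HasMaximalFormula d₂
HasMaximalFormula (∧E d₁ d₂)    = HasMaximalFormula d₁ ⊎ HasMaximalFormula d₂
HasMaximalFormula (⊃E d₁ d₂ d₃) = HasMaximalFormula d₁ ⊎ HasMaximalFormula d₂ ⊎ HasMaximalFormula d₃
HasMaximalFormula (∨E d₁ d₂ d₃) = HasMaximalFormula d₁ ⊎ HasMaximalFormula d₂ ⊎ HasMaximalFormula d₃
HasMaximalFormula (⊥E d)        = HasMaximalFormula d

-- `SegmentEndingAt d` : the occurrence of the conclusion of d is the last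
-- formula C_n of a sequence C_1, …, C_n (n > 1) of occurrences where each
-- C_i (i < n) is an arbitrary premise of the rule with conclusion C_{i+1}.
-- (An arbitrary premise always has the same formula as the conclusion.)
-- Constructors `…-start` : C_{n-1} is the start of the sequence;
-- constructors `…-more`  : the sequence continues above C_{n-1}.
data SegmentEndingAt {Γ} : ∀ {C} → Ded Γ C → Set where
  ∧I-start  : ∀ {A B C} {d₁ : Ded Γ A} {d₂ : Ded Γ B} {d₃ : Ded ((A ∧ B) ∷ Γ) C} →
              SegmentEndingAt (∧I d₁ d₂ d₃)
  ∧I-more   : ∀ {A B C} {d₁ : Ded Γ A} {d₂ : Ded Γ B} {d₃ : Ded ((A ∧ B) ∷ Γ) C} →
              SegmentEndingAt d₃ → SegmentEndingAt (∧I d₁ d₂ d₃)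
  ⊃I-start  : ∀ {A B C} {d₁ : Ded (A ∷ Γ) B} {d₂ : Ded ((A ⊃ B) ∷ Γ) C} →
              SegmentEndingAt (⊃I d₁ d₂)
  ⊃I-more   : ∀ {A B C} {d₁ : Ded (A ∷ Γ) B} {d₂ : Ded ((A ⊃ B) ∷ Γ) C} →
              SegmentEndingAt d₂ → SegmentEndingAt (⊃I d₁ d₂)
  ∨I₁-start : ∀ {A B C} {d₁ : Ded Γ A} {d₂ : Ded ((A ∨ B) ∷ Γ) C} →
              SegmentEndingAt (∨I₁ d₁ d₂)
  ∨I₁-more  : ∀ {A B C} {d₁ : Ded Γ A} {d₂ : Ded ((A ∨ B) ∷ Γ) C} →
              SegmentEndingAt d₂ → SegmentEndingAt (∨I₁ d₁ d₂)
  ∨I₂-start : ∀ {A B C} {d₁ : Ded Γ B} {d₂ : Ded ((A ∨ B) ∷ Γ) C} →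
              SegmentEndingAt (∨I₂ d₁ d₂)
  ∨I₂-more  : ∀ {A B C} {d₁ : Ded Γ B} {d₂ : Ded ((A ∨ B) ∷ Γ) C} →
              SegmentEndingAt d₂ → SegmentEndingAt (∨I₂ d₁ d₂)
  ∧E-start  : ∀ {A B C} {d₁ : Ded Γ (A ∧ B)} {d₂ : Ded (B ∷ A ∷ Γ) C} →
              SegmentEndingAt (∧E d₁ d₂)
  ∧E-more   : ∀ {A B C} {d₁ : Ded Γ (A ∧ B)} {d₂ : Ded (B ∷ A ∷ Γ) C} →
              SegmentEndingAt d₂ → SegmentEndingAt (∧E d₁ d₂)
  ⊃E-start  : ∀ {A B C} {d₁ : Ded Γ (A ⊃ B)} {d₂ : Ded Γ A} {d₃ : Ded (B ∷ Γ) C} →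
              SegmentEndingAt (⊃E d₁ d₂ d₃)
  ⊃E-more   : ∀ {A B C} {d₁ : Ded Γ (A ⊃ B)} {d₂ : Ded Γ A} {d₃ : Ded (B ∷ Γ) C} →
              SegmentEndingAt d₃ → SegmentEndingAt (⊃E d₁ d₂ d₃)
  ∨E-startˡ : ∀ {A B C} {d₁ : Ded Γ (A ∨ B)} {d₂ : Ded (A ∷ Γ) C} {d₃ : Ded (B ∷ Γ) C} →
              SegmentEndingAt (∨E d₁ d₂ d₃)
  ∨E-startʳ : ∀ {A B C} {d₁ : Ded Γ (A ∨ B)} {d₂ : Ded (A ∷ Γ) C} {d₃ : Ded (B ∷ Γ) C} →
              SegmentEndingAt (∨E d₁ d₂ d₃)
  ∨E-moreˡ  : ∀ {A B C} {d₁ : Ded Γ (A ∨ B)} {d₂ : Ded (A ∷ Γ) C} {d₃ : Ded (B ∷ Γ) C} →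
              SegmentEndingAt d₂ → SegmentEndingAt (∨E d₁ d₂ d₃)
  ∨E-moreʳ  : ∀ {A B C} {d₁ : Ded Γ (A ∨ B)} {d₂ : Ded (A ∷ Γ) C} {d₃ : Ded (B ∷ Γ) C} →
              SegmentEndingAt d₃ → SegmentEndingAt (∨E d₁ d₂ d₃)

-- `HasMaximalSegment d` : some segment in d ends with a major premise of an
-- elimination rule (such a last formula is never an arbitrary premise).
HasMaximalSegment : ∀ {Γ C} → Ded Γ C → Set
HasMaximalSegment (hyp x)       = ⊥
HasMaximalSegment (∧I d₁ d₂ d₃) = HasMaximalSegment d₁ ⊎ HasMaximalSegment d₂ ⊎ HasMaximalSegment d₃
HasMaximalSegment (⊃I d₁ d₂)    = HasMaximalSegment d₁ ⊎ HasMaximalSegment d₂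
HasMaximalSegment (∨I₁ d₁ d₂)   = HasMaximalSegment d₁ ⊎ HasMaximalSegment d₂
HasMaximalSegment (∨I₂ d₁ d₂)   = HasMaximalSegment d₁ ⊎ HasMaximalSegment d₂
HasMaximalSegment (∧E d₁ d₂)    = SegmentEndingAt d₁ ⊎ HasMaximalSegment d₁ ⊎ HasMaximalSegment d₂
HasMaximalSegment (⊃E d₁ d₂ d₃) = SegmentEndingAt d₁ ⊎ HasMaximalSegment d₁ ⊎ HasMaximalSegment d₂ ⊎ HasMaximalSegment d₃
HasMaximalSegment (∨E d₁ d₂ d₃) = SegmentEndingAt d₁ ⊎ HasMaximalSegment d₁ ⊎ HasMaximalSegment d₂ ⊎ HasMaximalSegment d₃
HasMaximalSegment (⊥E d)        = SegmentEndingAt d ⊎ HasMaximalSegment d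

Normal : ∀ {Γ C} → Ded Γ C → Set
Normal d = (HasMaximalFormula d → ⊥) × (HasMaximalSegment d → ⊥)

SubformulaProperty : ∀ {Γ C} → Ded Γ C → Set
SubformulaProperty {C = C} d =
  ∀ {F} → F ∈ forms d →
    F ⊑ C ⊎ Σ Form (λ A → UndischargedAssumption A d × F ⊑ A)

{-# OPTIONS --safe #-}
-- In a normal deduction the major premise of every elimination is an assumption:
-- every rule but ⊥E has an arbitrary premise, so a major premise concluded by such
-- a rule would end a maximal segment, and ⊥E only concludes atoms.  One then shows
-- by induction that every formula is a subformula of the conclusion or of an open
-- assumption class occurring as a major premise.  The major assumption discharged
-- by an introduction occurs in its arbitrary premise (no vacuous discharge) and is
-- not a major premise there (it would be maximal), so it is a subformula of the
-- conclusion, and so are the minor premises, which are subformulas of it.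
module Submission where

open import Defs
open import Data.Nat using (ℕ; suc)
open import Data.Fin.Properties using (toℕ-injective)
open import Data.List using (List; _∷_; _++_)
open import Data.List.Membership.Propositional using (_∈_)
open import Data.List.Membership.Propositional.Properties using (∈-++⁺ˡ; ∈-++⁺ʳ)
open import Data.List.Membership.Setoid.Properties using (index-injective)
open import Data.List.Relation.Unary.All using (All; []; _∷_; lookup)
  renaming (map to All-map)
open import Data.List.Relation.Unary.All.Properties using (++⁺)
open import Data.List.Relation.Unary.Any using (here; there)
open import Data.Product using (_×_; _,_)
open import Data.Sum using (_⊎_; inj₁; inj₂)
open import Data.Empty using (⊥; ⊥-elim)
open import Data.Unit using (⊤; tt)
open import Function using (_∘_)
open import Relation.Nullary using (¬_)
open import Relation.Binary.PropositionalEquality using (refl; setoid)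

⊑-trans : ∀ {F G H} → F ⊑ G → G ⊑ H → F ⊑ H
⊑-trans p ⊑-refl   = p
⊑-trans p (⊑-∧ˡ q) = ⊑-∧ˡ (⊑-trans p q)
⊑-trans p (⊑-∧ʳ q) = ⊑-∧ʳ (⊑-trans p q)
⊑-trans p (⊑-∨ˡ q) = ⊑-∨ˡ (⊑-trans p q)
⊑-trans p (⊑-∨ʳ q) = ⊑-∨ʳ (⊑-trans p q)
⊑-trans p (⊑-⊃ˡ q) = ⊑-⊃ˡ (⊑-trans p q)
⊑-trans p (⊑-⊃ʳ q) = ⊑-⊃ʳ (⊑-trans p q)

data Covered (Γ : List Form) (C : Form) (P : ℕ → Set) (F : Form) : Set where
  by-conclusion : F ⊑ C → Covered Γ C P F
  by-assumption : ∀ {A} (x : A ∈ Γ) → P (idx x) → F ⊑ A → Covered Γ C P F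

module _ {Γ : List Form} {C : Form} {P : ℕ → Set} where

  Covered-map : ∀ {Q : ℕ → Set} {F} → (∀ {k} → P k → Q k) → Covered Γ C P F → Covered Γ C Q F
  Covered-map f (by-conclusion s)     = by-conclusion s
  Covered-map f (by-assumption x p s) = by-assumption x (f p) s

  Covered-⊑ : ∀ {F G} → F ⊑ G → Covered Γ C P G → Covered Γ C P F
  Covered-⊑ s (by-conclusion t)     = by-conclusion (⊑-trans s t)
  Covered-⊑ s (by-assumption x p t) = by-assumption x p (⊑-trans s t)

  Covered-via : ∀ {B F} → Covered Γ C P B → Covered Γ B P F → Covered Γ C P F
  Covered-via c (by-conclusion s)     = Covered-⊑ s c
  Covered-via c (by-assumption x p s) = by-assumption x p s

module _ {Γ : List Form} {C D : Form} {P : ℕ → Set} where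

  Covered-pop : ∀ {F} → Covered (D ∷ Γ) C P F → (F ⊑ D × P 0) ⊎ Covered Γ C (P ∘ suc) F
  Covered-pop (by-conclusion s)               = inj₂ (by-conclusion s)
  Covered-pop (by-assumption (here refl) p s) = inj₁ (s , p)
  Covered-pop (by-assumption (there x) p s)   = inj₂ (by-assumption x p s)

  Covered-drop : ∀ {F} → ¬ P 0 → Covered (D ∷ Γ) C P F → Covered Γ C (P ∘ suc) F
  Covered-drop ¬p c with Covered-pop c
  ... | inj₁ (_ , p) = ⊥-elim (¬p p)
  ... | inj₂ c′      = c′

StrongSubformulaProperty : ∀ {Γ C} → Ded Γ C → Set
StrongSubformulaProperty {Γ} {C} d = All (Covered Γ C (λ k → MajorPremAt k d)) (forms d)

∈-premiseˡ : ∀ {A : Set} {C F : A} {xs ys} → F ∈ xs → F ∈ C ∷ xs ++ ys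
∈-premiseˡ p = there (∈-++⁺ˡ p)

∈-premiseʳ : ∀ {A : Set} {C F : A} xs {ys} → F ∈ ys → F ∈ C ∷ xs ++ ys
∈-premiseʳ xs p = there (∈-++⁺ʳ xs p)

∈-premise₂ : ∀ {A : Set} {C F : A} xs {ys zs} → F ∈ ys → F ∈ C ∷ xs ++ ys ++ zs
∈-premise₂ xs p = there (∈-++⁺ʳ xs (∈-++⁺ˡ p))

∈-premise₃ : ∀ {A : Set} {C F : A} xs ys {zs} → F ∈ zs → F ∈ C ∷ xs ++ ys ++ zs
∈-premise₃ xs ys p = there (∈-++⁺ʳ xs (∈-++⁺ʳ ys p))

Uses⇒∈forms : ∀ {Γ A C} (x : A ∈ Γ) (d : Ded Γ C) → Uses (idx x) d → A ∈ forms d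
Uses⇒∈forms x (hyp y) e with index-injective (setoid Form) y x (toℕ-injective e)
... | refl = here refl
Uses⇒∈forms x (∧I d₁ d₂ d₃) (inj₁ u)          = ∈-premiseˡ (Uses⇒∈forms x d₁ u)
Uses⇒∈forms x (∧I d₁ d₂ d₃) (inj₂ (inj₁ u))   = ∈-premise₂ (forms d₁) ((Uses⇒∈forms x d₂ u))
Uses⇒∈forms x (∧I d₁ d₂ d₃) (inj₂ (inj₂ u))   = ∈-premise₃ (forms d₁) (forms d₂) ((Uses⇒∈forms (there x) d₃ u))
Uses⇒∈forms x (⊃I d₁ d₂) (inj₁ u)             = ∈-premiseˡ (Uses⇒∈forms (there x) d₁ u)
Uses⇒∈forms x (⊃I d₁ d₂) (inj₂ u)             = ∈-premiseʳ (forms d₁) (Uses⇒∈forms (there x) d₂ u)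
Uses⇒∈forms x (∨I₁ d₁ d₂) (inj₁ u)            = ∈-premiseˡ (Uses⇒∈forms x d₁ u)
Uses⇒∈forms x (∨I₁ d₁ d₂) (inj₂ u)            = ∈-premiseʳ (forms d₁) (Uses⇒∈forms (there x) d₂ u)
Uses⇒∈forms x (∨I₂ d₁ d₂) (inj₁ u)            = ∈-premiseˡ (Uses⇒∈forms x d₁ u)
Uses⇒∈forms x (∨I₂ d₁ d₂) (inj₂ u)            = ∈-premiseʳ (forms d₁) (Uses⇒∈forms (there x) d₂ u)
Uses⇒∈forms x (∧E d₁ d₂) (inj₁ u)             = ∈-premiseˡ (Uses⇒∈forms x d₁ u)
Uses⇒∈forms x (∧E d₁ d₂) (inj₂ u)             = ∈-premiseʳ (forms d₁) (Uses⇒∈forms (there (there x)) d₂ u)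
Uses⇒∈forms x (⊃E d₁ d₂ d₃) (inj₁ u)          = ∈-premiseˡ (Uses⇒∈forms x d₁ u)
Uses⇒∈forms x (⊃E d₁ d₂ d₃) (inj₂ (inj₁ u))   = ∈-premise₂ (forms d₁) ((Uses⇒∈forms x d₂ u))
Uses⇒∈forms x (⊃E d₁ d₂ d₃) (inj₂ (inj₂ u))   = ∈-premise₃ (forms d₁) (forms d₂) ((Uses⇒∈forms (there x) d₃ u))
Uses⇒∈forms x (∨E d₁ d₂ d₃) (inj₁ u)          = ∈-premiseˡ (Uses⇒∈forms x d₁ u)
Uses⇒∈forms x (∨E d₁ d₂ d₃) (inj₂ (inj₁ u))   = ∈-premise₂ (forms d₁) ((Uses⇒∈forms (there x) d₂ u))
Uses⇒∈forms x (∨E d₁ d₂ d₃) (inj₂ (inj₂ u))   = ∈-premise₃ (forms d₁) (forms d₂) ((Uses⇒∈forms (there x) d₃ u))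
Uses⇒∈forms x (⊥E d) u                        = there (Uses⇒∈forms x d u)

IsHyp⇒Uses : ∀ {Γ C} k (d : Ded Γ C) → IsHyp k d → Uses k d
IsHyp⇒Uses k (hyp x) e = e

MajorPremAt⇒Uses : ∀ {Γ C} k (d : Ded Γ C) → MajorPremAt k d → Uses k d
MajorPremAt⇒Uses k (∧I d₁ d₂ d₃) (inj₁ m)                  = inj₁ (MajorPremAt⇒Uses k d₁ m)
MajorPremAt⇒Uses k (∧I d₁ d₂ d₃) (inj₂ (inj₁ m))           = inj₂ (inj₁ (MajorPremAt⇒Uses k d₂ m))
MajorPremAt⇒Uses k (∧I d₁ d₂ d₃) (inj₂ (inj₂ m))           = inj₂ (inj₂ (MajorPremAt⇒Uses (suc k) d₃ m))
MajorPremAt⇒Uses k (⊃I d₁ d₂) (inj₁ m)                     = inj₁ (MajorPremAt⇒Uses (suc k) d₁ m)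
MajorPremAt⇒Uses k (⊃I d₁ d₂) (inj₂ m)                     = inj₂ (MajorPremAt⇒Uses (suc k) d₂ m)
MajorPremAt⇒Uses k (∨I₁ d₁ d₂) (inj₁ m)                    = inj₁ (MajorPremAt⇒Uses k d₁ m)
MajorPremAt⇒Uses k (∨I₁ d₁ d₂) (inj₂ m)                    = inj₂ (MajorPremAt⇒Uses (suc k) d₂ m)
MajorPremAt⇒Uses k (∨I₂ d₁ d₂) (inj₁ m)                    = inj₁ (MajorPremAt⇒Uses k d₁ m)
MajorPremAt⇒Uses k (∨I₂ d₁ d₂) (inj₂ m)                    = inj₂ (MajorPremAt⇒Uses (suc k) d₂ m)
MajorPremAt⇒Uses k (∧E d₁ d₂) (inj₁ m)                     = inj₁ (IsHyp⇒Uses k d₁ m)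
MajorPremAt⇒Uses k (∧E d₁ d₂) (inj₂ (inj₁ m))              = inj₁ (MajorPremAt⇒Uses k d₁ m)
MajorPremAt⇒Uses k (∧E d₁ d₂) (inj₂ (inj₂ m))              = inj₂ (MajorPremAt⇒Uses (suc (suc k)) d₂ m)
MajorPremAt⇒Uses k (⊃E d₁ d₂ d₃) (inj₁ m)                  = inj₁ (IsHyp⇒Uses k d₁ m)
MajorPremAt⇒Uses k (⊃E d₁ d₂ d₃) (inj₂ (inj₁ m))           = inj₁ (MajorPremAt⇒Uses k d₁ m)
MajorPremAt⇒Uses k (⊃E d₁ d₂ d₃) (inj₂ (inj₂ (inj₁ m)))    = inj₂ (inj₁ (MajorPremAt⇒Uses k d₂ m))
MajorPremAt⇒Uses k (⊃E d₁ d₂ d₃) (inj₂ (inj₂ (inj₂ m)))    = inj₂ (inj₂ (MajorPremAt⇒Uses (suc k) d₃ m))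
MajorPremAt⇒Uses k (∨E d₁ d₂ d₃) (inj₁ m)                  = inj₁ (IsHyp⇒Uses k d₁ m)
MajorPremAt⇒Uses k (∨E d₁ d₂ d₃) (inj₂ (inj₁ m))           = inj₁ (MajorPremAt⇒Uses k d₁ m)
MajorPremAt⇒Uses k (∨E d₁ d₂ d₃) (inj₂ (inj₂ (inj₁ m)))    = inj₂ (inj₁ (MajorPremAt⇒Uses (suc k) d₂ m))
MajorPremAt⇒Uses k (∨E d₁ d₂ d₃) (inj₂ (inj₂ (inj₂ m)))    = inj₂ (inj₂ (MajorPremAt⇒Uses (suc k) d₃ m))
MajorPremAt⇒Uses k (⊥E d) (inj₁ m)                         = IsHyp⇒Uses k d m
MajorPremAt⇒Uses k (⊥E d) (inj₂ m)                         = MajorPremAt⇒Uses k d m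

IsAtomic : Form → Set
IsAtomic (atom _) = ⊤
IsAtomic _        = ⊥

data IsAssumption {Γ} : ∀ {D} → Ded Γ D → Set where
  assumption : ∀ {D} (x : D ∈ Γ) → IsAssumption (hyp x)

¬segment-end⇒assumption : ∀ {Γ D} (d : Ded Γ D) → ¬ IsAtomic D → ¬ SegmentEndingAt d → IsAssumption d
¬segment-end⇒assumption (hyp x) _ _              = assumption x
¬segment-end⇒assumption (∧I d₁ d₂ d₃) _ ¬s       = ⊥-elim (¬s ∧I-start)
¬segment-end⇒assumption (⊃I d₁ d₂) _ ¬s          = ⊥-elim (¬s ⊃I-start)
¬segment-end⇒assumption (∨I₁ d₁ d₂) _ ¬s         = ⊥-elim (¬s ∨I₁-start)
¬segment-end⇒assumption (∨I₂ d₁ d₂) _ ¬s         = ⊥-elim (¬s ∨I₂-start)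
¬segment-end⇒assumption (∧E d₁ d₂) _ ¬s          = ⊥-elim (¬s ∧E-start)
¬segment-end⇒assumption (⊃E d₁ d₂ d₃) _ ¬s       = ⊥-elim (¬s ⊃E-start)
¬segment-end⇒assumption (∨E d₁ d₂ d₃) _ ¬s       = ⊥-elim (¬s ∨E-startˡ)
¬segment-end⇒assumption (⊥E d) ¬atomic _         = ⊥-elim (¬atomic tt)

discharged-covered : ∀ {Γ C D} (d : Ded (D ∷ Γ) C) → Uses 0 d → ¬ MajorPremAt 0 d →
                     StrongSubformulaProperty d → Covered Γ C (λ k → MajorPremAt (suc k) d) D
discharged-covered d u ¬m s = Covered-drop ¬m (lookup s (Uses⇒∈forms (here refl) d u))

∧I-strong : ∀ {Γ A B C} {d₁ : Ded Γ A} {d₂ : Ded Γ B} {d₃ : Ded ((A ∧ B) ∷ Γ) C} →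
            Uses 0 d₃ → ¬ MajorPremAt 0 d₃ →
            StrongSubformulaProperty d₁ → StrongSubformulaProperty d₂ → StrongSubformulaProperty d₃ →
            StrongSubformulaProperty (∧I d₁ d₂ d₃)
∧I-strong {Γ} {A} {B} {C} {d₁} {d₂} {d₃} u ¬m s₁ s₂ s₃ =
  by-conclusion ⊑-refl
    ∷ ++⁺ (All-map (Covered-via (Covered-⊑ (⊑-∧ˡ ⊑-refl) A∧B) ∘ Covered-map inj₁) s₁)
      (++⁺ (All-map (Covered-via (Covered-⊑ (⊑-∧ʳ ⊑-refl) A∧B) ∘ Covered-map (inj₂ ∘ inj₁)) s₂)
           (All-map (Covered-map (inj₂ ∘ inj₂) ∘ Covered-drop ¬m) s₃))
  where
  A∧B : Covered Γ C (λ k → MajorPremAt k (∧I d₁ d₂ d₃)) (A ∧ B)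
  A∧B = Covered-map (inj₂ ∘ inj₂) (discharged-covered d₃ u ¬m s₃)

⊃I-strong : ∀ {Γ A B C} {d₁ : Ded (A ∷ Γ) B} {d₂ : Ded ((A ⊃ B) ∷ Γ) C} →
            Uses 0 d₂ → ¬ MajorPremAt 0 d₂ →
            StrongSubformulaProperty d₁ → StrongSubformulaProperty d₂ →
            StrongSubformulaProperty (⊃I d₁ d₂)
⊃I-strong {Γ} {A} {B} {C} {d₁} {d₂} u ¬m s₁ s₂ =
  by-conclusion ⊑-refl
    ∷ ++⁺ (All-map minor s₁) (All-map (Covered-map inj₂ ∘ Covered-drop ¬m) s₂)
  where
  A⊃B : Covered Γ C (λ k → MajorPremAt k (⊃I d₁ d₂)) (A ⊃ B)
  A⊃B = Covered-map inj₂ (discharged-covered d₂ u ¬m s₂)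
  minor : ∀ {F} → Covered (A ∷ Γ) B (λ k → MajorPremAt k d₁) F →
          Covered Γ C (λ k → MajorPremAt k (⊃I d₁ d₂)) F
  minor c with Covered-pop c
  ... | inj₁ (F⊑A , _) = Covered-⊑ (⊑-⊃ˡ F⊑A) A⊃B
  ... | inj₂ c′        = Covered-via (Covered-⊑ (⊑-⊃ʳ ⊑-refl) A⊃B) (Covered-map inj₁ c′)

∨I₁-strong : ∀ {Γ A B C} {d₁ : Ded Γ A} {d₂ : Ded ((A ∨ B) ∷ Γ) C} →
             Uses 0 d₂ → ¬ MajorPremAt 0 d₂ →
             StrongSubformulaProperty d₁ → StrongSubformulaProperty d₂ →
             StrongSubformulaProperty (∨I₁ d₁ d₂)
∨I₁-strong {d₂ = d₂} u ¬m s₁ s₂ =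
  by-conclusion ⊑-refl
    ∷ ++⁺ (All-map (Covered-via (Covered-⊑ (⊑-∨ˡ ⊑-refl) A∨B) ∘ Covered-map inj₁) s₁)
          (All-map (Covered-map inj₂ ∘ Covered-drop ¬m) s₂)
  where A∨B = Covered-map inj₂ (discharged-covered d₂ u ¬m s₂)

∨I₂-strong : ∀ {Γ A B C} {d₁ : Ded Γ B} {d₂ : Ded ((A ∨ B) ∷ Γ) C} →
             Uses 0 d₂ → ¬ MajorPremAt 0 d₂ →
             StrongSubformulaProperty d₁ → StrongSubformulaProperty d₂ →
             StrongSubformulaProperty (∨I₂ d₁ d₂)
∨I₂-strong {d₂ = d₂} u ¬m s₁ s₂ =
  by-conclusion ⊑-refl
    ∷ ++⁺ (All-map (Covered-via (Covered-⊑ (⊑-∨ʳ ⊑-refl) A∨B) ∘ Covered-map inj₁) s₁)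
          (All-map (Covered-map inj₂ ∘ Covered-drop ¬m) s₂)
  where A∨B = Covered-map inj₂ (discharged-covered d₂ u ¬m s₂)

∧E-strong : ∀ {Γ A B C} (x : (A ∧ B) ∈ Γ) {d : Ded (B ∷ A ∷ Γ) C} →
            StrongSubformulaProperty d → StrongSubformulaProperty (∧E (hyp x) d)
∧E-strong {Γ} {A} {B} {C} x {d} s = by-conclusion ⊑-refl ∷ A∧B ∷ All-map arbitrary s
  where
  A∧B : Covered Γ C (λ k → MajorPremAt k (∧E (hyp x) d)) (A ∧ B)
  A∧B = by-assumption x (inj₁ refl) ⊑-refl
  arbitrary : ∀ {F} → Covered (B ∷ A ∷ Γ) C (λ k → MajorPremAt k d) F →
              Covered Γ C (λ k → MajorPremAt k (∧E (hyp x) d)) F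
  arbitrary c with Covered-pop c
  ... | inj₁ (F⊑B , _) = Covered-⊑ (⊑-∧ʳ F⊑B) A∧B
  ... | inj₂ c′ with Covered-pop c′
  ...   | inj₁ (F⊑A , _) = Covered-⊑ (⊑-∧ˡ F⊑A) A∧B
  ...   | inj₂ c″        = Covered-map (inj₂ ∘ inj₂) c″

⊃E-strong : ∀ {Γ A B C} (x : (A ⊃ B) ∈ Γ) {d₁ : Ded Γ A} {d₂ : Ded (B ∷ Γ) C} →
            StrongSubformulaProperty d₁ → StrongSubformulaProperty d₂ →
            StrongSubformulaProperty (⊃E (hyp x) d₁ d₂)
⊃E-strong {Γ} {A} {B} {C} x {d₁} {d₂} s₁ s₂ =
  by-conclusion ⊑-refl
    ∷ A⊃B ∷ ++⁺ (All-map (Covered-via (Covered-⊑ (⊑-⊃ˡ ⊑-refl) A⊃B) ∘ Covered-map (inj₂ ∘ inj₂ ∘ inj₁)) s₁)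
                (All-map arbitrary s₂)
  where
  A⊃B : Covered Γ C (λ k → MajorPremAt k (⊃E (hyp x) d₁ d₂)) (A ⊃ B)
  A⊃B = by-assumption x (inj₁ refl) ⊑-refl
  arbitrary : ∀ {F} → Covered (B ∷ Γ) C (λ k → MajorPremAt k d₂) F →
              Covered Γ C (λ k → MajorPremAt k (⊃E (hyp x) d₁ d₂)) F
  arbitrary c with Covered-pop c
  ... | inj₁ (F⊑B , _) = Covered-⊑ (⊑-⊃ʳ F⊑B) A⊃B
  ... | inj₂ c′        = Covered-map (inj₂ ∘ inj₂ ∘ inj₂) c′

∨E-strong : ∀ {Γ A B C} (x : (A ∨ B) ∈ Γ) {d₁ : Ded (A ∷ Γ) C} {d₂ : Ded (B ∷ Γ) C} →
            StrongSubformulaProperty d₁ → StrongSubformulaProperty d₂ →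
            StrongSubformulaProperty (∨E (hyp x) d₁ d₂)
∨E-strong {Γ} {A} {B} {C} x {d₁} {d₂} s₁ s₂ =
  by-conclusion ⊑-refl ∷ A∨B ∷ ++⁺ (All-map left s₁) (All-map right s₂)
  where
  A∨B : Covered Γ C (λ k → MajorPremAt k (∨E (hyp x) d₁ d₂)) (A ∨ B)
  A∨B = by-assumption x (inj₁ refl) ⊑-refl
  left : ∀ {F} → Covered (A ∷ Γ) C (λ k → MajorPremAt k d₁) F →
         Covered Γ C (λ k → MajorPremAt k (∨E (hyp x) d₁ d₂)) F
  left c with Covered-pop c
  ... | inj₁ (F⊑A , _) = Covered-⊑ (⊑-∨ˡ F⊑A) A∨B
  ... | inj₂ c′        = Covered-map (inj₂ ∘ inj₂ ∘ inj₁) c′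
  right : ∀ {F} → Covered (B ∷ Γ) C (λ k → MajorPremAt k d₂) F →
          Covered Γ C (λ k → MajorPremAt k (∨E (hyp x) d₁ d₂)) F
  right c with Covered-pop c
  ... | inj₁ (F⊑B , _) = Covered-⊑ (⊑-∨ʳ F⊑B) A∨B
  ... | inj₂ c′        = Covered-map (inj₂ ∘ inj₂ ∘ inj₂) c′

⊥E-strong : ∀ {Γ n} (x : ⊥' ∈ Γ) → StrongSubformulaProperty (⊥E {n = n} (hyp x))
⊥E-strong x = by-conclusion ⊑-refl ∷ by-assumption x (inj₁ refl) ⊑-refl ∷ []

strong-subformula-property : ∀ {Γ C} (d : Ded Γ C) → NoVacuous d →
                             ¬ HasMaximalFormula d → ¬ HasMaximalSegment d →
                             StrongSubformulaProperty d
strong-subformula-property (hyp x) _ _ _ = by-conclusion ⊑-refl ∷ []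
strong-subformula-property (∧I d₁ d₂ d₃) (u , v₁ , v₂ , v₃) ¬f ¬s =
  ∧I-strong u (¬f ∘ inj₁)
    (strong-subformula-property d₁ v₁ (¬f ∘ inj₂ ∘ inj₁) (¬s ∘ inj₁))
    (strong-subformula-property d₂ v₂ (¬f ∘ inj₂ ∘ inj₂ ∘ inj₁) (¬s ∘ inj₂ ∘ inj₁))
    (strong-subformula-property d₃ v₃ (¬f ∘ inj₂ ∘ inj₂ ∘ inj₂) (¬s ∘ inj₂ ∘ inj₂))
strong-subformula-property (⊃I d₁ d₂) (u , v₁ , v₂) ¬f ¬s =
  ⊃I-strong u (¬f ∘ inj₁)
    (strong-subformula-property d₁ v₁ (¬f ∘ inj₂ ∘ inj₁) (¬s ∘ inj₁))
    (strong-subformula-property d₂ v₂ (¬f ∘ inj₂ ∘ inj₂) (¬s ∘ inj₂))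
strong-subformula-property (∨I₁ d₁ d₂) (u , v₁ , v₂) ¬f ¬s =
  ∨I₁-strong u (¬f ∘ inj₁)
    (strong-subformula-property d₁ v₁ (¬f ∘ inj₂ ∘ inj₁) (¬s ∘ inj₁))
    (strong-subformula-property d₂ v₂ (¬f ∘ inj₂ ∘ inj₂) (¬s ∘ inj₂))
strong-subformula-property (∨I₂ d₁ d₂) (u , v₁ , v₂) ¬f ¬s =
  ∨I₂-strong u (¬f ∘ inj₁)
    (strong-subformula-property d₁ v₁ (¬f ∘ inj₂ ∘ inj₁) (¬s ∘ inj₁))
    (strong-subformula-property d₂ v₂ (¬f ∘ inj₂ ∘ inj₂) (¬s ∘ inj₂))
strong-subformula-property (∧E d₁ d₂) (_ , _ , _ , v₂) ¬f ¬s
  with ¬segment-end⇒assumption d₁ (λ ()) (¬s ∘ inj₁)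
... | assumption x =
  ∧E-strong x (strong-subformula-property d₂ v₂ (¬f ∘ inj₂) (¬s ∘ inj₂ ∘ inj₂))
strong-subformula-property (⊃E d₁ d₂ d₃) (_ , _ , v₂ , v₃) ¬f ¬s
  with ¬segment-end⇒assumption d₁ (λ ()) (¬s ∘ inj₁)
... | assumption x =
  ⊃E-strong x
    (strong-subformula-property d₂ v₂ (¬f ∘ inj₂ ∘ inj₁) (¬s ∘ inj₂ ∘ inj₂ ∘ inj₁))
    (strong-subformula-property d₃ v₃ (¬f ∘ inj₂ ∘ inj₂) (¬s ∘ inj₂ ∘ inj₂ ∘ inj₂))
strong-subformula-property (∨E d₁ d₂ d₃) (_ , _ , _ , v₂ , v₃) ¬f ¬s
  with ¬segment-end⇒assumption d₁ (λ ()) (¬s ∘ inj₁)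
... | assumption x =
  ∨E-strong x
    (strong-subformula-property d₂ v₂ (¬f ∘ inj₂ ∘ inj₁) (¬s ∘ inj₂ ∘ inj₂ ∘ inj₁))
    (strong-subformula-property d₃ v₃ (¬f ∘ inj₂ ∘ inj₂) (¬s ∘ inj₂ ∘ inj₂ ∘ inj₂))
strong-subformula-property (⊥E d) _ _ ¬s
  with ¬segment-end⇒assumption d (λ ()) (¬s ∘ inj₁)
... | assumption x = ⊥E-strong x

theorem3 : ∀ {Γ C} (d : Ded Γ C) → NoVacuous d → Normal d → SubformulaProperty d
theorem3 d nv (¬f , ¬s) F∈d with lookup (strong-subformula-property d nv ¬f ¬s) F∈d
... | by-conclusion F⊑C          = inj₁ F⊑C
... | by-assumption {A} x m F⊑A = inj₂ (A , (x , MajorPremAt⇒Uses (idx x) d m) , F⊑A)
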